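{- Let $z_0\ge2$, $z\ge1$ and $\tau$ a positive integer coprime to $P(z_0)$. For any two distinct primes $p_1,p_2$, $$\max\Bigl(2,\frac{p_1p_2}{\varphi(p_1p_2)}\Bigr)\ge w_{p_1p_2}(z;z_0,\tau)\,G_\tau(z;z_0)\,\varphi(p_1p_2)\ge0.$$
   Context: $\mu$ is the Möbius function, $\varphi$ Euler's totient, $P(z_0)=\prod_{p<z_0}p$. For a positive integer $d$ and $y>0$, $G_d(y;z_0)=\sum_{\ell\le y,\,(\ell,dP(z_0))=1}\mu^2(\ell)/\varphi(\ell)$. Let $\varphi_2(n)=\prod_{p\mid n}(p-2)$. For squarefree $q$ and $y>0$, $\xi_q(y)=\sum_{q_1q_2q_3=q,\ q_1q_3\le y,\ q_2q_3\le y}\mu(q_3)\varphi_2(q_3)/\varphi(q_3)$, and $G_{[q]}(z;z_0,\tau)=\sum_{\ell\le z/\sqrt q,\,(\ell,q\tau P(z_0))=1}\frac{\mu^2(\ell)}{\varphi(\ell)}\xi_q(z/\ell)$. For $q$ squarefree and coprime to $\tau P(z_0)$, $w_q(z;z_0,\tau)=\frac{\mu(q)}{\varphi(q)G_\tau(z;z_0)}\cdot\frac{G_{[q]}(z;z_0,\tau)}{G_\tau(z;z_0)}$; for all other $q$, $w_q(z;z_0,\tau)=0$. -}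

module Defs where

open import Data.Bool using (Bool; true; false; if_then_else_; _∧_; not)
open import Data.Nat as ℕ using (ℕ; zero; suc; _≤ᵇ_; _≡ᵇ_)
open import Data.Nat.Divisibility using (_∣?_)
open import Data.Nat.Primality using (prime?)
open import Data.Nat.Coprimality using (coprime?)
open import Data.Integer as ℤ using (ℤ; +_; -[1+_])
open import Data.Rational as ℚ using (ℚ; 0ℚ; _/_; _+_; _*_)
open import Data.List using (List; []; _∷_; foldr; filterᵇ; length; map; concatMap; drop; upTo)
open import Relation.Nullary.Decidable using (does; yes; no)
open import Data.Product using (_×_; _,_)
import Data.Rational.Properties as ℚP

range1 : ℕ → List ℕ
range1 n = drop 1 (upTo (suc n))

sumℚ : List ℚ → ℚ
sumℚ = foldr _+_ 0ℚ

prodℕ : List ℕ → ℕ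
prodℕ = foldr ℕ._*_ 1

divides? : ℕ → ℕ → Bool
divides? d n = does (d ∣? n)

isPrime : ℕ → Bool
isPrime p = does (prime? p)

coprimeᵇ : ℕ → ℕ → Bool
coprimeᵇ a b = does (coprime? a b)

primesBelow : ℕ → List ℕ
primesBelow n = filterᵇ isPrime (upTo n)

-- P(z0) = ∏_{p < z0} p, with z0 encoded by its ceiling n0
Pz : ℕ → ℕ
Pz n0 = prodℕ (primesBelow n0)

primeDivisors : ℕ → List ℕ
primeDivisors n = filterᵇ (λ p → isPrime p ∧ divides? p n) (range1 n)

squarefreeᵇ : ℕ → Bool
squarefreeᵇ n = foldr _∧_ true (map (λ d → not (divides? (d ℕ.* d) n)) (drop 2 (upTo (suc n))))

μ : ℕ → ℤ
μ n = if squarefreeᵇ n then sgn (length (primeDivisors n)) else + 0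
  where
  sgn : ℕ → ℤ
  sgn zero = + 1
  sgn (suc zero) = -[1+ 0 ]
  sgn (suc (suc k)) = sgn k

φ : ℕ → ℕ
φ n = length (filterᵇ (λ k → coprimeᵇ k n) (range1 n))

φ₂ : ℕ → ℤ
φ₂ n = foldr (λ p acc → (+ p ℤ.- + 2) ℤ.* acc) (+ 1) (primeDivisors n)

-- total division: a / d, and 0 when d = 0
frac : ℤ → ℕ → ℚ
frac a zero = 0ℚ
frac a (suc d) = a / suc d

ofℕ : ℕ → ℚ
ofℕ n = frac (+ n) 1

-- total quotient of rationals: 0 when denominator is 0
_÷'_ : ℚ → ℚ → ℚ
p ÷' q with q ℚP.≟ 0ℚ
... | yes _ = 0ℚ
... | no q≢0 = ℚ._÷_ p q {{ℚ.≢-nonZero q≢0}}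

-- Encoding of the real parameters:
--   z0 ≥ 2 real  ↦  n0 = ⌈z0⌉ ≥ 2   (p < z0 ⟺ p < n0 for integers p)
--   z ≥ 1 real   ↦  N = ⌊z⌋, M = ⌊z²⌋  (integer m ≤ z ⟺ m ≤ N, m ≤ z² ⟺ m ≤ M)

G : ℕ → ℕ → ℕ → ℚ
G d n0 N = sumℚ (map (λ ℓ → frac (μ ℓ ℤ.* μ ℓ) (φ ℓ))
                     (filterᵇ (λ ℓ → coprimeᵇ ℓ (d ℕ.* Pz n0)) (range1 N)))

triples : ℕ → List (ℕ × ℕ × ℕ)
triples q = filterᵇ (λ { (a , b , c) → (a ℕ.* b ℕ.* c) ≡ᵇ q })
  (concatMap (λ a → concatMap (λ b → map (λ c → (a , b , c)) (range1 q)) (range1 q)) (range1 q))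

-- ξ_q(z/ℓ) = Σ_{q1q2q3 = q, q1q3 ≤ z/ℓ, q2q3 ≤ z/ℓ} μ(q3)φ₂(q3)/φ(q3)
-- (for ℓ ≥ 1: q1q3 ≤ z/ℓ ⟺ ℓ q1 q3 ≤ ⌊z⌋ = N)
ξ : ℕ → ℕ → ℕ → ℚ
ξ q ℓ N = sumℚ (map (λ { (a , b , c) → frac (μ c ℤ.* φ₂ c) (φ c) })
  (filterᵇ (λ { (a , b , c) → ((ℓ ℕ.* a ℕ.* c) ≤ᵇ N) ∧ ((ℓ ℕ.* b ℕ.* c) ≤ᵇ N) }) (triples q)))

-- G_[q](z; z0, τ) = Σ_{ℓ ≤ z/√q, (ℓ, qτP(z0)) = 1} μ²(ℓ)/φ(ℓ) ξ_q(z/ℓ)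
-- (ℓ ≤ z/√q ⟺ ℓ² q ≤ z² ⟺ ℓ² q ≤ ⌊z²⌋ = M)
Gbr : ℕ → ℕ → ℕ → ℕ → ℕ → ℚ
Gbr q n0 τ N M = sumℚ (map (λ ℓ → frac (μ ℓ ℤ.* μ ℓ) (φ ℓ) * ξ q ℓ N)
  (filterᵇ (λ ℓ → ((ℓ ℕ.* ℓ ℕ.* q) ≤ᵇ M) ∧ coprimeᵇ ℓ (q ℕ.* τ ℕ.* Pz n0)) (range1 M)))

w : ℕ → ℕ → ℕ → ℕ → ℕ → ℚ
w q n0 τ N M =
  if squarefreeᵇ q ∧ coprimeᵇ q (τ ℕ.* Pz n0)
  then (frac (μ q) (φ q) ÷' G τ n0 N) * (Gbr q n0 τ N M ÷' G τ n0 N)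
  else 0ℚ

-- For q = p₁p₂, ξ_q(y) is a sum over the nine ordered factorizations q = q₁q₂q₃, with summand
-- μ(q₃)φ₂(q₃)/φ(q₃) equal to 1, -(p-2)/(p-1) or (p₁-2)(p₂-2)/φ(q) according as q₃ = 1, p or q.
-- If q ≤ y all nine are admissible and ξ_q(y) = q/φ(q); otherwise only (p₁,p₂,1) and (p₂,p₁,1)
-- can be, so ξ_q(y) ∈ {0, 2}. Hence 0 ≤ ξ_q ≤ C = max(2, q/φ(q)), and since ℓ²q ≤ z² forces ℓ ≤ z,
-- the ℓ counted in G_[q] are among those counted in G_τ, giving 0 ≤ G_[q] ≤ C G_τ. As μ(q) = 1,
-- w_q G_τ φ(q) is G_[q]/G_τ, or 0 when q is not squarefree, not coprime to τP(z₀), or G_τ = 0.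
module Submission where

open import Defs
open import Data.Bool using (Bool; true; false; T; not; _∧_; if_then_else_)
open import Data.Bool.Properties using (T?; T-∧)
open import Data.Empty using (⊥-elim)
open import Data.Fin using (#_)
import Data.Integer
open import Data.Integer as ℤ using (ℤ; +_; -[1+_])
import Data.Integer.Properties as ℤ
open import Data.Integer.Tactic.RingSolver using () renaming (ring to ℤ-ring)
open import Data.List using (List; []; _∷_; _++_; [_]; map; foldr; filterᵇ; concatMap; length)
open import Data.List.Membership.Propositional using (_∈_; find; lose)
open import Data.List.Membership.Propositional.Properties
  using (∈-filter⁺; ∈-filter⁻; ∈-applyUpTo⁺; ∈-applyUpTo⁻; ∈-concatMap⁺; ∈-concatMap⁻; ∈-lookup;
         ∈-map⁺; ∈-map⁻; ∈-++⁺ˡ; ∈-++⁺ʳ; ∈-++⁻)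
open import Data.List.Membership.Propositional.Properties.WithK using (unique∧set⇒bag)
open import Data.List.Properties using (filter-++; filter-none; applyUpTo-∷ʳ; ++-identityʳ; length-applyUpTo; length-map; length-++)
open import Data.List.Relation.Binary.BagAndSetEquality using (∼bag⇒↭)
open import Data.List.Relation.Binary.Disjoint.Propositional using (Disjoint)
open import Data.List.Relation.Binary.Permutation.Propositional as ↭ using (_↭_; prep; swap)
open import Data.List.Relation.Binary.Permutation.Propositional.Properties using (filter-↭; ↭-length)
import Data.List.Relation.Binary.Permutation.Propositional.Properties as ↭
open import Data.List.Relation.Unary.All using (All; []; _∷_)
import Data.List.Relation.Unary.All as All
open import Data.List.Relation.Unary.All.Properties using (all⁻; applyUpTo⁺₂)
open import Data.List.Relation.Unary.AllPairs using ([]; _∷_)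
open import Data.List.Relation.Unary.Any using (here; there)
open import Data.List.Relation.Unary.Unique.Propositional using (Unique)
open import Data.List.Relation.Unary.Unique.Propositional.Properties
  using (++⁺; map⁺; filter⁺; applyUpTo⁺₁; Unique[x∷xs]⇒x∉xs)
open import Data.Maybe using (nothing)
open import Data.Nat using (ℕ; zero; suc; _≤_; _<_; _≤ᵇ_; s≤s; z≤n; NonZero)
import Data.Nat as N
import Data.Nat.Properties as N
open import Data.Nat.Tactic.RingSolver using () renaming (ring to ℕ-ring)
open import Data.Nat.Coprimality using (Coprime; coprime?; prime⇒coprime)
import Data.Nat.Coprimality as Coprime
open import Data.Nat.Divisibility
  using (_∣_; _∣?_; divides; 0∣⇒≡0; ∣-refl; ∣-trans; ∣⇒≤; m∣m*n; n∣m*n; n∣m*n*o; ∣m⇒∣m*n; ∣n⇒∣m*n; m*n∣⇒m∣; *-cancelʳ-∣)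
open import Data.Nat.Primality
  using (Prime; prime?; prime⇒irreducible; prime⇒nonZero; prime⇒nonTrivial; ¬prime[0]; ¬prime[1]; euclidsLemma)
open import Data.Product using (_×_; _,_; proj₁; proj₂)
open import Data.Rational using (ℚ; 0ℚ; 1ℚ; _+_; _*_; _-_; -_; 1/_; _⊔_)
import Data.Rational as Q
import Data.Rational.Properties as Q
open import Data.Rational.Unnormalised using (mkℚᵘ; *≡*) renaming (_≃_ to _≃ᵘ_)
import Data.Rational.Unnormalised as U
import Data.Rational.Unnormalised.Properties as U
open import Data.Sum using (_⊎_; inj₁; inj₂)
open import Function using (_∘_; _⇔_; mk⇔; Equivalence)
open import Level using (0ℓ)
open import Relation.Binary.PropositionalEquality
  using (_≡_; _≢_; refl; sym; trans; cong; cong₂; subst; ≢-sym; module ≡-Reasoning)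
open import Relation.Nullary using (¬_; Dec; yes; no; does)
open import Relation.Nullary.Decidable using (True; toWitness)
open import Tactic.RingSolver using (solve-∀)
open import Tactic.RingSolver.Core.AlmostCommutativeRing using (AlmostCommutativeRing; fromCommutativeRing)

↭-from-⇔ : ∀ {A : Set} {xs ys : List A} → Unique xs → Unique ys →
           (∀ {x} → x ∈ xs ⇔ x ∈ ys) → xs ↭ ys
↭-from-⇔ uxs uys xs⇔ys = ∼bag⇒↭ (unique∧set⇒bag uxs uys xs⇔ys)

foldr-↭ : ∀ {A B : Set} (f : A → B → B) (e : B) → (∀ x y z → f x (f y z) ≡ f y (f x z)) →
          ∀ {xs ys} → xs ↭ ys → foldr f e xs ≡ foldr f e ys
foldr-↭ f e comm ↭.refl = refl
foldr-↭ f e comm (prep x p) = cong (f x) (foldr-↭ f e comm p)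
foldr-↭ f e comm (swap x y p) = trans (cong (f x ∘ f y) (foldr-↭ f e comm p)) (comm x y _)
foldr-↭ f e comm (↭.trans p q) = trans (foldr-↭ f e comm p) (foldr-↭ f e comm q)

Unique-concatMap : ∀ {A B : Set} (f : A → List B) {xs : List A} → Unique xs →
                   (∀ x → Unique (f x)) → (∀ {x y v} → v ∈ f x → v ∈ f y → x ≡ y) →
                   Unique (concatMap f xs)
Unique-concatMap f {[]} _ _ _ = []
Unique-concatMap f {x ∷ xs} u@(_ ∷ uxs) uf tag = ++⁺ (uf x) (Unique-concatMap f uxs uf tag) disjoint
  where
  disjoint : Disjoint (f x) (concatMap f xs)
  disjoint (v∈fx , v∈rest) with find (∈-concatMap⁻ f {xs = xs} v∈rest)
  ... | y , y∈xs , v∈fy with tag v∈fx v∈fy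
  ... | refl = Unique[x∷xs]⇒x∉xs u y∈xs

cube : List ℕ → List (ℕ × ℕ × ℕ)
cube xs = concatMap (λ a → concatMap (λ b → map (λ c → (a , b , c)) xs) xs) xs

∈-cube : ∀ {xs a b c} → a ∈ xs → b ∈ xs → c ∈ xs → (a , b , c) ∈ cube xs
∈-cube a∈ b∈ c∈ = ∈-concatMap⁺ _ (lose a∈ (∈-concatMap⁺ _ (lose b∈ (∈-map⁺ _ c∈))))

Unique-cube : ∀ {xs} → Unique xs → Unique (cube xs)
Unique-cube {xs} u =
  Unique-concatMap _ u (λ a → Unique-concatMap _ u (λ b → map⁺ (cong (proj₂ ∘ proj₂)) u) same-b) same-a
  where
  same-b : ∀ {a b b′ v} → v ∈ map (λ c → (a , b , c)) xs → v ∈ map (λ c → (a , b′ , c)) xs → b ≡ b′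
  same-b v∈ v∈′ with ∈-map⁻ _ v∈ | ∈-map⁻ _ v∈′
  ... | _ , _ , refl | _ , _ , v≡ = cong (proj₁ ∘ proj₂) v≡
  same-a : ∀ {a a′ v} → v ∈ concatMap (λ b → map (λ c → (a , b , c)) xs) xs →
           v ∈ concatMap (λ b → map (λ c → (a′ , b , c)) xs) xs → a ≡ a′
  same-a v∈ v∈′ with find (∈-concatMap⁻ _ {xs = xs} v∈) | find (∈-concatMap⁻ _ {xs = xs} v∈′)
  ... | _ , _ , w∈ | _ , _ , w∈′ with ∈-map⁻ _ w∈ | ∈-map⁻ _ w∈′
  ... | _ , _ , refl | _ , _ , v≡ = cong proj₁ v≡

length-filterᵇ-partition : ∀ {A : Set} (p : A → Bool) xs →
  length (filterᵇ p xs) N.+ length (filterᵇ (not ∘ p) xs) ≡ length xs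
length-filterᵇ-partition p [] = refl
length-filterᵇ-partition p (x ∷ xs) with p x
... | true = cong suc (length-filterᵇ-partition p xs)
... | false = trans (N.+-suc _ _) (cong suc (length-filterᵇ-partition p xs))

T-does⁺ : ∀ {P : Set} (P? : Dec P) → P → T (does P?)
T-does⁺ (yes _) _ = _
T-does⁺ (no ¬p) p = ¬p p

T-does⁻ : ∀ {P : Set} (P? : Dec P) → T (does P?) → P
T-does⁻ (yes p) _ = p

T-not-does⁺ : ∀ {P : Set} (P? : Dec P) → ¬ P → T (not (does P?))
T-not-does⁺ (yes p) ¬p = ¬p p
T-not-does⁺ (no _) _ = _

T-not-does⁻ : ∀ {P : Set} (P? : Dec P) → T (not (does P?)) → ¬ P
T-not-does⁻ (no ¬p) _ = ¬p

∈-range1⁺ : ∀ {x n} → 1 ≤ x → x ≤ n → x ∈ range1 n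
∈-range1⁺ {suc x} (s≤s _) x≤n = ∈-applyUpTo⁺ suc x≤n

∈-range1⁻ : ∀ {x n} → x ∈ range1 n → 1 ≤ x × x ≤ n
∈-range1⁻ {n = n} x∈ with ∈-applyUpTo⁻ suc {n = n} x∈
... | _ , i<n , refl = s≤s z≤n , i<n

Unique-range1 : ∀ n → Unique (range1 n)
Unique-range1 n = applyUpTo⁺₁ suc n (λ i<j _ → N.<⇒≢ i<j ∘ N.suc-injective)

divisor-∈-range1 : ∀ {d n} .{{_ : NonZero n}} → d ∣ n → d ∈ range1 n
divisor-∈-range1 {zero} {n} 0∣n = ⊥-elim (N.≢-nonZero⁻¹ n (0∣⇒≡0 0∣n))
divisor-∈-range1 {suc d} d∣n = ∈-range1⁺ (s≤s z≤n) (∣⇒≤ d∣n)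

filterᵇ-range1-↭ : ∀ (p : ℕ → Bool) n {xs} → Unique xs →
                   (∀ {x} → x ∈ xs → 1 ≤ x × x ≤ n × T (p x)) →
                   (∀ {x} → 1 ≤ x → x ≤ n → T (p x) → x ∈ xs) →
                   filterᵇ p (range1 n) ↭ xs
filterᵇ-range1-↭ p n uxs sound complete =
  ↭-from-⇔ (filter⁺ (T? ∘ p) (Unique-range1 n)) uxs (mk⇔ to from)
  where
  to : ∀ {x} → x ∈ filterᵇ p (range1 n) → x ∈ _
  to x∈ with ∈-filter⁻ (T? ∘ p) {xs = range1 n} x∈
  ... | x∈range , px with ∈-range1⁻ x∈range
  ... | 1≤x , x≤n = complete 1≤x x≤n px
  from : ∀ {x} → x ∈ _ → x ∈ filterᵇ p (range1 n)
  from x∈xs with sound x∈xs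
  ... | 1≤x , x≤n , px = ∈-filter⁺ (T? ∘ p) (∈-range1⁺ 1≤x x≤n) px

filterᵇ-range1-+ : ∀ (p : ℕ → Bool) n k → (∀ ℓ → T (p ℓ) → ℓ ≤ n) →
                   filterᵇ p (range1 (n N.+ k)) ≡ filterᵇ p (range1 n)
filterᵇ-range1-+ p n zero bounded = cong (filterᵇ p ∘ range1) (N.+-identityʳ n)
filterᵇ-range1-+ p n (suc k) bounded = begin
  filterᵇ p (range1 (n N.+ suc k))                ≡⟨ cong (filterᵇ p) range1-last ⟩
  filterᵇ p (range1 (n N.+ k) ++ [ m ])           ≡⟨ filter-++ (T? ∘ p) (range1 (n N.+ k)) [ m ] ⟩
  filterᵇ p (range1 (n N.+ k)) ++ filterᵇ p [ m ] ≡⟨ cong (filterᵇ p (range1 (n N.+ k)) ++_)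
                                                          (filter-none (T? ∘ p) (m-rejected ∷ [])) ⟩
  filterᵇ p (range1 (n N.+ k)) ++ []              ≡⟨ ++-identityʳ _ ⟩
  filterᵇ p (range1 (n N.+ k))                    ≡⟨ filterᵇ-range1-+ p n k bounded ⟩
  filterᵇ p (range1 n)                            ∎
  where
  open ≡-Reasoning
  m : ℕ
  m = suc (n N.+ k)
  range1-last : range1 (n N.+ suc k) ≡ range1 (n N.+ k) ++ [ m ]
  range1-last = trans (cong range1 (N.+-suc n k)) (sym (applyUpTo-∷ʳ suc (n N.+ k)))
  m-rejected : ¬ T (p m)
  m-rejected pm = N.<⇒≱ (s≤s (N.m≤m+n n k)) (bounded m pm)

ℚ-ring : AlmostCommutativeRing 0ℓ 0ℓ
ℚ-ring = fromCommutativeRing Q.+-*-commutativeRing (λ _ → nothing)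

fromℤ : ℤ → ℚ
fromℤ i = frac i 1

toℚᵘ-frac : ∀ i d → Q.toℚᵘ (frac i (suc d)) ≃ᵘ mkℚᵘ i d
toℚᵘ-frac i d = Q.toℚᵘ-fromℚᵘ (mkℚᵘ i d)

fromℤ-+ : ∀ i j → fromℤ (i ℤ.+ j) ≡ fromℤ i + fromℤ j
fromℤ-+ i j = Q.toℚᵘ-injective (begin
  Q.toℚᵘ (fromℤ (i ℤ.+ j))                  ≈⟨ toℚᵘ-frac (i ℤ.+ j) 0 ⟩
  mkℚᵘ (i ℤ.+ j) 0                          ≈⟨ *≡* (normalise i j) ⟩
  mkℚᵘ i 0 U.+ mkℚᵘ j 0                     ≈⟨ U.+-cong (toℚᵘ-frac i 0) (toℚᵘ-frac j 0) ⟨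
  Q.toℚᵘ (fromℤ i) U.+ Q.toℚᵘ (fromℤ j)     ≈⟨ Q.toℚᵘ-homo-+ (fromℤ i) (fromℤ j) ⟨
  Q.toℚᵘ (fromℤ i + fromℤ j)                ∎)
  where
  open U.≃-Reasoning
  normalise : ∀ i j → (i ℤ.+ j) ℤ.* + 1 ≡ (i ℤ.* + 1 ℤ.+ j ℤ.* + 1) ℤ.* + 1
  normalise = solve-∀ ℤ-ring

fromℤ-* : ∀ i j → fromℤ (i ℤ.* j) ≡ fromℤ i * fromℤ j
fromℤ-* i j = Q.toℚᵘ-injective (begin
  Q.toℚᵘ (fromℤ (i ℤ.* j))                  ≈⟨ toℚᵘ-frac (i ℤ.* j) 0 ⟩
  mkℚᵘ i 0 U.* mkℚᵘ j 0                     ≈⟨ U.*-cong (toℚᵘ-frac i 0) (toℚᵘ-frac j 0) ⟨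
  Q.toℚᵘ (fromℤ i) U.* Q.toℚᵘ (fromℤ j)     ≈⟨ Q.toℚᵘ-homo-* (fromℤ i) (fromℤ j) ⟨
  Q.toℚᵘ (fromℤ i * fromℤ j)                ∎)
  where open U.≃-Reasoning

fromℤ-neg : ∀ i → fromℤ (ℤ.- i) ≡ - fromℤ i
fromℤ-neg i = Q.toℚᵘ-injective (begin
  Q.toℚᵘ (fromℤ (ℤ.- i))                    ≈⟨ toℚᵘ-frac (ℤ.- i) 0 ⟩
  U.- mkℚᵘ i 0                              ≈⟨ U.-‿cong (toℚᵘ-frac i 0) ⟨
  U.- Q.toℚᵘ (fromℤ i)                      ≈⟨ Q.toℚᵘ-homo‿- (fromℤ i) ⟨
  Q.toℚᵘ (- fromℤ i)                        ∎)
  where open U.≃-Reasoning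

fromℤ-minus : ∀ i j → fromℤ (i ℤ.- j) ≡ fromℤ i - fromℤ j
fromℤ-minus i j = trans (fromℤ-+ i (ℤ.- j)) (cong (λ x → fromℤ i + x) (fromℤ-neg j))

ofℕ-suc : ∀ n → ofℕ (suc n) ≡ 1ℚ + ofℕ n
ofℕ-suc n = fromℤ-+ (+ 1) (+ n)

ofℕ-* : ∀ m n → ofℕ (m N.* n) ≡ ofℕ m * ofℕ n
ofℕ-* m n = trans (cong fromℤ (ℤ.pos-* m n)) (fromℤ-* (+ m) (+ n))

ofℕ-≢0 : ∀ n .{{_ : NonZero n}} → ofℕ n ≢ 0ℚ
ofℕ-≢0 n ofℕn≡0 = Q.<-irrefl refl (subst (0ℚ Q.<_) ofℕn≡0 (Q.positive⁻¹ _ {{Q.normalize-pos n 1}}))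

frac-*-ofℕ : ∀ i n .{{_ : NonZero n}} → frac i n * ofℕ n ≡ fromℤ i
frac-*-ofℕ i (suc d) = Q.toℚᵘ-injective (begin
  Q.toℚᵘ (frac i (suc d) * ofℕ (suc d))              ≈⟨ Q.toℚᵘ-homo-* (frac i (suc d)) (ofℕ (suc d)) ⟩
  Q.toℚᵘ (frac i (suc d)) U.* Q.toℚᵘ (ofℕ (suc d))   ≈⟨ U.*-cong (toℚᵘ-frac i d) (toℚᵘ-frac (+ suc d) 0) ⟩
  mkℚᵘ i d U.* mkℚᵘ (+ suc d) 0                      ≈⟨ *≡* cancel-d ⟩
  mkℚᵘ i 0                                           ≈⟨ toℚᵘ-frac i 0 ⟨
  Q.toℚᵘ (fromℤ i)                                   ∎)
  where
  open U.≃-Reasoning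
  cancel-d : i ℤ.* + suc d ℤ.* + 1 ≡ i ℤ.* + (suc d N.* 1)
  cancel-d = trans (ℤ.*-identityʳ _) (cong (λ m → i ℤ.* + m) (sym (N.*-identityʳ (suc d))))

frac-nonNeg : ∀ n d → 0ℚ Q.≤ frac (+ n) d
frac-nonNeg n zero = Q.≤-refl
frac-nonNeg n (suc d) = Q.nonNegative⁻¹ _ {{Q.normalize-nonNeg n (suc d)}}

frac-square-nonNeg : ∀ i d → 0ℚ Q.≤ frac (i ℤ.* i) d
frac-square-nonNeg (+ n) d = subst (λ j → 0ℚ Q.≤ frac j d) (ℤ.pos-* n n) (frac-nonNeg (n N.* n) d)
frac-square-nonNeg -[1+ n ] d = frac-nonNeg (suc n N.* suc n) d

*-nonNeg : ∀ {x y} → 0ℚ Q.≤ x → 0ℚ Q.≤ y → 0ℚ Q.≤ x * y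
*-nonNeg {x} {y} x≥0 y≥0 =
  Q.≤-trans (Q.≤-reflexive (sym (Q.*-zeroˡ y))) (Q.*-monoʳ-≤-nonNeg y {{Q.nonNegative y≥0}} x≥0)

1/-nonNeg : ∀ g .{{_ : Q.NonZero g}} → 0ℚ Q.≤ g → 0ℚ Q.≤ 1/ g
1/-nonNeg (Q.mkℚ (ℤ.+[1+ _ ]) _ _) _ = Q.nonNegative⁻¹ _
1/-nonNeg (Q.mkℚ -[1+ _ ] _ _) (Q.*≤* ())

*-cancelʳ-≡ : ∀ x y z → z ≢ 0ℚ → x * z ≡ y * z → x ≡ y
*-cancelʳ-≡ x y z z≢0 xz≡yz = begin
  x                  ≡⟨ cancel x ⟨
  (x * z) * (1/ z)   ≡⟨ cong (_* (1/ z)) xz≡yz ⟩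
  (y * z) * (1/ z)   ≡⟨ cancel y ⟩
  y                  ∎
  where
  open ≡-Reasoning
  instance
    z-nonZero : Q.NonZero z
    z-nonZero = Q.≢-nonZero z≢0
  cancel : ∀ w → (w * z) * (1/ z) ≡ w
  cancel w = trans (Q.*-assoc w z (1/ z)) (trans (cong (w *_) (Q.*-inverseʳ z)) (Q.*-identityʳ w))

÷'-≢0 : ∀ x g (g≢0 : g ≢ 0ℚ) → x ÷' g ≡ x * (1/ g) {{Q.≢-nonZero g≢0}}
÷'-≢0 x g g≢0 with g Q.≟ 0ℚ
... | yes g≡0 = ⊥-elim (g≢0 g≡0)
... | no _ = refl

*-1/-bounds : ∀ b g c → 0ℚ Q.≤ g → (g≢0 : g ≢ 0ℚ) → 0ℚ Q.≤ b → b Q.≤ c * g →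
              let instance _ = Q.≢-nonZero g≢0 in 0ℚ Q.≤ b * 1/ g × b * 1/ g Q.≤ c
*-1/-bounds b g c g≥0 g≢0 b≥0 b≤cg =
  *-nonNeg b≥0 (1/-nonNeg g g≥0) ,
  Q.≤-trans (Q.*-monoʳ-≤-nonNeg (1/ g) b≤cg)
            (Q.≤-reflexive (trans (Q.*-assoc c g (1/ g)) (trans (cong (c *_) (Q.*-inverseʳ g)) (Q.*-identityʳ c))))
  where
  instance
    g-nonZero : Q.NonZero g
    g-nonZero = Q.≢-nonZero g≢0
    1/g-nonNeg : Q.NonNegative (1/ g)
    1/g-nonNeg = Q.nonNegative (1/-nonNeg g g≥0)

≤-by-computation : ∀ {x y} → True (x Q.≤? y) → x Q.≤ y
≤-by-computation = toWitness

[_]·_ : Bool → ℚ → ℚ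
[ b ]· x = if b then x else 0ℚ

sumℚ-map-filterᵇ : ∀ {A : Set} (f : A → ℚ) (p : A → Bool) xs →
                   sumℚ (map f (filterᵇ p xs)) ≡ foldr (λ x s → [ p x ]· f x + s) 0ℚ xs
sumℚ-map-filterᵇ f p [] = refl
sumℚ-map-filterᵇ f p (x ∷ xs) with p x
... | true = cong (λ s → f x + s) (sumℚ-map-filterᵇ f p xs)
... | false = trans (sumℚ-map-filterᵇ f p xs) (sym (Q.+-identityˡ _))

sumℚ-map-filterᵇ-↭ : ∀ {A : Set} (f : A → ℚ) (p : A → Bool) {xs ys} → xs ↭ ys →
                     sumℚ (map f (filterᵇ p xs)) ≡ sumℚ (map f (filterᵇ p ys))
sumℚ-map-filterᵇ-↭ f p xs↭ys = foldr-↭ _+_ 0ℚ +-left-comm (↭.map⁺ f (filter-↭ (T? ∘ p) xs↭ys))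
  where
  +-left-comm : ∀ x y z → x + (y + z) ≡ y + (x + z)
  +-left-comm = solve-∀ ℚ-ring

sumℚ-map-nonNeg : ∀ {A : Set} (f : A → ℚ) xs → (∀ x → 0ℚ Q.≤ f x) → 0ℚ Q.≤ sumℚ (map f xs)
sumℚ-map-nonNeg f [] _ = Q.≤-refl
sumℚ-map-nonNeg f (x ∷ xs) f≥0 = Q.+-mono-≤ (f≥0 x) (sumℚ-map-nonNeg f xs f≥0)

sumℚ-map-≤-* : ∀ {A : Set} (f g : A → ℚ) c xs → (∀ x → f x Q.≤ c * g x) →
               sumℚ (map f xs) Q.≤ c * sumℚ (map g xs)
sumℚ-map-≤-* f g c [] _ = Q.≤-reflexive (sym (Q.*-zeroʳ c))
sumℚ-map-≤-* f g c (x ∷ xs) f≤cg =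
  Q.≤-trans (Q.+-mono-≤ (f≤cg x) (sumℚ-map-≤-* f g c xs f≤cg))
            (Q.≤-reflexive (sym (Q.*-distribˡ-+ c (g x) (sumℚ (map g xs)))))

sumℚ-map-filterᵇ-mono : ∀ {A : Set} (g : A → ℚ) (p p′ : A → Bool) xs → (∀ x → 0ℚ Q.≤ g x) →
                        (∀ x → T (p x) → T (p′ x)) →
                        sumℚ (map g (filterᵇ p xs)) Q.≤ sumℚ (map g (filterᵇ p′ xs))
sumℚ-map-filterᵇ-mono g p p′ [] _ _ = Q.≤-refl
sumℚ-map-filterᵇ-mono g p p′ (x ∷ xs) g≥0 p⇒p′
  with p x in px | p′ x in p′x | sumℚ-map-filterᵇ-mono g p p′ xs g≥0 p⇒p′
... | true  | true  | rest = Q.+-monoʳ-≤ (g x) rest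
... | true  | false | _    = ⊥-elim (subst T p′x (p⇒p′ x (subst T (sym px) _)))
... | false | true  | rest = Q.≤-trans rest (Q.≤-trans (Q.≤-reflexive (sym (Q.+-identityˡ _))) (Q.+-monoˡ-≤ _ (g≥0 x)))
... | false | false | rest = rest

-- With A = p₁ - 1 and B = p₂ - 1 this is 4 - 2(A-1)/A - 2(B-1)/B + (A-1)(B-1)/AB = (1+A)(1+B)/AB,
-- the value of ξ_{p₁p₂} once all nine factorizations are admissible.
ξ-full-sum-identity : ∀ A B u₁ u₂ u₁₂ r → A * B ≢ 0ℚ →
  u₁ * A ≡ 1ℚ - A → u₂ * B ≡ 1ℚ - B →
  u₁₂ * (A * B) ≡ (A - 1ℚ) * (B - 1ℚ) → r * (A * B) ≡ (1ℚ + A) * (1ℚ + B) →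
  1ℚ + (1ℚ + (1ℚ + (1ℚ + (u₁ + (u₁ + (u₂ + (u₂ + (u₁₂ + 0ℚ)))))))) ≡ r
ξ-full-sum-identity A B u₁ u₂ u₁₂ r AB≢0 e₁ e₂ e₁₂ eʳ = *-cancelʳ-≡ _ r (A * B) AB≢0 (begin
  (1ℚ + (1ℚ + (1ℚ + (1ℚ + (u₁ + (u₁ + (u₂ + (u₂ + (u₁₂ + 0ℚ))))))))) * (A * B)
    ≡⟨ distribute A B u₁ u₂ u₁₂ ⟩
  E (u₁ * A) (u₂ * B) (u₁₂ * (A * B))
    ≡⟨ cong₂ (λ X Y → E X Y (u₁₂ * (A * B))) e₁ e₂ ⟩
  E (1ℚ - A) (1ℚ - B) (u₁₂ * (A * B))
    ≡⟨ cong (E (1ℚ - A) (1ℚ - B)) e₁₂ ⟩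
  E (1ℚ - A) (1ℚ - B) ((A - 1ℚ) * (B - 1ℚ))
    ≡⟨ collect A B ⟩
  (1ℚ + A) * (1ℚ + B)
    ≡⟨ eʳ ⟨
  r * (A * B)
    ∎)
  where
  open ≡-Reasoning
  E : ℚ → ℚ → ℚ → ℚ
  E X Y Z = (1ℚ + 1ℚ + 1ℚ + 1ℚ) * (A * B) + (X + X) * B + (Y + Y) * A + Z
  distribute : ∀ A B u₁ u₂ u₁₂ →
    (1ℚ + (1ℚ + (1ℚ + (1ℚ + (u₁ + (u₁ + (u₂ + (u₂ + (u₁₂ + 0ℚ))))))))) * (A * B) ≡
    (1ℚ + 1ℚ + 1ℚ + 1ℚ) * (A * B) + (u₁ * A + u₁ * A) * B + (u₂ * B + u₂ * B) * A + u₁₂ * (A * B)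
  distribute = solve-∀ ℚ-ring
  collect : ∀ A B →
    (1ℚ + 1ℚ + 1ℚ + 1ℚ) * (A * B) + ((1ℚ - A) + (1ℚ - A)) * B + ((1ℚ - B) + (1ℚ - B)) * A + (A - 1ℚ) * (B - 1ℚ) ≡
    (1ℚ + A) * (1ℚ + B)
  collect = solve-∀ ℚ-ring

-- Arithmetic functions at a prime

prime⇒2≤ : ∀ {p} → Prime p → 2 ≤ p
prime⇒2≤ {p} pr = N.nonTrivial⇒n>1 p {{prime⇒nonTrivial pr}}

prime⇒≢1 : ∀ {p} → Prime p → p ≢ 1
prime⇒≢1 pr refl = ¬prime[1] pr

prime-product : ∀ {p b c} → Prime p → b N.* c ≡ p → (b ≡ 1 × c ≡ p) ⊎ (b ≡ p × c ≡ 1)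
prime-product {p} {b} {c} pr bc≡p with prime⇒irreducible pr (divides c (trans (sym bc≡p) (N.*-comm b c)))
... | inj₁ refl = inj₁ (refl , trans (sym (N.*-identityˡ c)) bc≡p)
... | inj₂ refl = inj₂ (refl , N.*-cancelˡ-≡ c 1 b {{prime⇒nonZero pr}} (trans bc≡p (sym (N.*-identityʳ b))))

prime∤⇒coprime : ∀ {p d} → Prime p → ¬ p ∣ d → Coprime d p
prime∤⇒coprime pr p∤d (c∣d , c∣p) with prime⇒irreducible pr c∣p
... | inj₁ c≡1 = c≡1
... | inj₂ refl = ⊥-elim (p∤d c∣d)

squarefree-prime : ∀ {p} → Prime p → T (squarefreeᵇ p)
squarefree-prime {zero} pr = ⊥-elim (¬prime[0] pr)
squarefree-prime {suc zero} pr = ⊥-elim (¬prime[1] pr)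
squarefree-prime {p@(suc (suc k))} pr =
  all⁻ (λ d → not (divides? (d N.* d) p))
       (applyUpTo⁺₂ (λ i → suc (suc i)) (suc k) (λ i → T-not-does⁺ (_ ∣? p) (square∤ i)))
  where
  square∤ : ∀ i → ¬ (suc (suc i) N.* suc (suc i)) ∣ p
  square∤ i d²∣p with prime⇒irreducible pr (m*n∣⇒m∣ (suc (suc i)) (suc (suc i)) d²∣p)
  ... | inj₁ ()
  ... | inj₂ refl = N.<⇒≱ (N.m<m*n p p (s≤s (s≤s z≤n))) (∣⇒≤ d²∣p)

isPrimeDivisor⁺ : ∀ {x n} → Prime x → x ∣ n → T (isPrime x ∧ divides? x n)
isPrimeDivisor⁺ {x} {n} px x∣n = Equivalence.from T-∧ (T-does⁺ (prime? x) px , T-does⁺ (x ∣? n) x∣n)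

isPrimeDivisor⁻ : ∀ {x n} → T (isPrime x ∧ divides? x n) → Prime x × x ∣ n
isPrimeDivisor⁻ {x} {n} t with Equivalence.to T-∧ t
... | isPrime-x , x-divides = T-does⁻ (prime? x) isPrime-x , T-does⁻ (x ∣? n) x-divides

primeDivisors-↭ : ∀ n .{{_ : NonZero n}} {xs} → Unique xs →
                  (∀ {x} → x ∈ xs → Prime x × x ∣ n) → (∀ {x} → Prime x → x ∣ n → x ∈ xs) →
                  primeDivisors n ↭ xs
primeDivisors-↭ n {xs} uxs sound complete = filterᵇ-range1-↭ _ n uxs sound′ complete′
  where
  sound′ : ∀ {x} → x ∈ xs → 1 ≤ x × x ≤ n × T (isPrime x ∧ divides? x n)
  sound′ x∈ with sound x∈
  ... | px , x∣n = N.≤-trans (s≤s z≤n) (prime⇒2≤ px) , ∣⇒≤ x∣n , isPrimeDivisor⁺ px x∣n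
  complete′ : ∀ {x} → 1 ≤ x → x ≤ n → T (isPrime x ∧ divides? x n) → x ∈ xs
  complete′ _ _ t with isPrimeDivisor⁻ t
  ... | px , x∣n = complete px x∣n

nonCoprimes : ℕ → List ℕ
nonCoprimes n = filterᵇ (not ∘ λ k → coprimeᵇ k n) (range1 n)

nonCoprimes-↭ : ∀ n {xs} → Unique xs →
                (∀ {x} → x ∈ xs → 1 ≤ x × x ≤ n × ¬ Coprime x n) →
                (∀ {x} → 1 ≤ x → x ≤ n → ¬ Coprime x n → x ∈ xs) →
                nonCoprimes n ↭ xs
nonCoprimes-↭ n {xs} uxs sound complete = filterᵇ-range1-↭ _ n uxs sound′ complete′
  where
  sound′ : ∀ {x} → x ∈ xs → 1 ≤ x × x ≤ n × T (not (coprimeᵇ x n))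
  sound′ {x} x∈ with sound x∈
  ... | 1≤x , x≤n , ¬cop = 1≤x , x≤n , T-not-does⁺ (coprime? x n) ¬cop
  complete′ : ∀ {x} → 1 ≤ x → x ≤ n → T (not (coprimeᵇ x n)) → x ∈ xs
  complete′ {x} 1≤x x≤n t = complete 1≤x x≤n (T-not-does⁻ (coprime? x n) t)

φ+length-nonCoprimes : ∀ n {xs} → nonCoprimes n ↭ xs → φ n N.+ length xs ≡ n
φ+length-nonCoprimes n {xs} nonCoprimes↭xs = begin
  φ n N.+ length xs               ≡⟨ cong (φ n N.+_) (↭-length nonCoprimes↭xs) ⟨
  φ n N.+ length (nonCoprimes n)  ≡⟨ length-filterᵇ-partition _ (range1 n) ⟩
  length (range1 n)               ≡⟨ length-applyUpTo suc n ⟩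
  n                               ∎
  where open ≡-Reasoning

μ-one-prime-divisor : ∀ n → T (squarefreeᵇ n) → length (primeDivisors n) ≡ 1 → μ n ≡ -[1+ 0 ]
μ-one-prime-divisor n squarefree one with squarefreeᵇ n
... | true rewrite one = refl

μ-two-prime-divisors : ∀ n → T (squarefreeᵇ n) → length (primeDivisors n) ≡ 2 → μ n ≡ + 1
μ-two-prime-divisors n squarefree two with squarefreeᵇ n
... | true rewrite two = refl

φ₂-↭ : ∀ n {xs} → primeDivisors n ↭ xs → φ₂ n ≡ foldr (λ p acc → (+ p ℤ.- + 2) ℤ.* acc) (+ 1) xs
φ₂-↭ n = foldr-↭ _ (+ 1) (λ x y → left-comm (+ x ℤ.- + 2) (+ y ℤ.- + 2))
  where
  left-comm : ∀ a b c → a ℤ.* (b ℤ.* c) ≡ b ℤ.* (a ℤ.* c)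
  left-comm = solve-∀ ℤ-ring

primeDivisors-prime : ∀ {p} → Prime p → primeDivisors p ↭ [ p ]
primeDivisors-prime {p} pr = primeDivisors-↭ p {{prime⇒nonZero pr}} ([] ∷ []) sound complete
  where
  sound : ∀ {x} → x ∈ [ p ] → Prime x × x ∣ p
  sound (here refl) = pr , ∣-refl
  complete : ∀ {x} → Prime x → x ∣ p → x ∈ [ p ]
  complete px x∣p with prime⇒irreducible pr x∣p
  ... | inj₁ refl = ⊥-elim (¬prime[1] px)
  ... | inj₂ refl = here refl

nonCoprimes-prime : ∀ {p} → Prime p → nonCoprimes p ↭ [ p ]
nonCoprimes-prime {p} pr = nonCoprimes-↭ p ([] ∷ []) sound complete
  where
  sound : ∀ {x} → x ∈ [ p ] → 1 ≤ x × x ≤ p × ¬ Coprime x p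
  sound (here refl) = N.≤-trans (s≤s z≤n) (prime⇒2≤ pr) , N.≤-refl , λ cop → prime⇒≢1 pr (cop (∣-refl , ∣-refl))
  complete : ∀ {x} → 1 ≤ x → x ≤ p → ¬ Coprime x p → x ∈ [ p ]
  complete {x} 1≤x x≤p ¬cop with x N.≟ p
  ... | yes refl = here refl
  ... | no x≢p = ⊥-elim (¬cop (Coprime.sym (prime⇒coprime pr {{N.>-nonZero 1≤x}} (N.≤∧≢⇒< x≤p x≢p))))

μ-prime : ∀ {p} → Prime p → μ p ≡ -[1+ 0 ]
μ-prime {p} pr = μ-one-prime-divisor p (squarefree-prime pr) (↭-length (primeDivisors-prime pr))

φ₂-prime : ∀ {p} → Prime p → φ₂ p ≡ (+ p ℤ.- + 2) ℤ.* + 1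
φ₂-prime {p} pr = φ₂-↭ p (primeDivisors-prime pr)

suc-φ-prime : ∀ {p} → Prime p → suc (φ p) ≡ p
suc-φ-prime {p} pr = trans (N.+-comm 1 (φ p)) (φ+length-nonCoprimes p (nonCoprimes-prime pr))

φ-prime-nonZero : ∀ {p} → Prime p → NonZero (φ p)
φ-prime-nonZero pr = N.>-nonZero (N.≤-pred (subst (2 ≤_) (sym (suc-φ-prime pr)) (prime⇒2≤ pr)))

μ*φ₂-prime : ∀ {p} → Prime p → μ p ℤ.* φ₂ p ≡ + 1 ℤ.- + φ p
μ*φ₂-prime {p} pr = begin
  μ p ℤ.* φ₂ p                                  ≡⟨ cong₂ ℤ._*_ (μ-prime pr) (φ₂-prime pr) ⟩
  -[1+ 0 ] ℤ.* ((+ p ℤ.- + 2) ℤ.* + 1)           ≡⟨ cong (λ n → -[1+ 0 ] ℤ.* ((+ n ℤ.- + 2) ℤ.* + 1)) (suc-φ-prime pr) ⟨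
  -[1+ 0 ] ℤ.* ((+ suc (φ p) ℤ.- + 2) ℤ.* + 1)   ≡⟨ normalise (+ φ p) ⟩
  + 1 ℤ.- + φ p                                 ∎
  where
  open ≡-Reasoning
  normalise : ∀ a → -[1+ 0 ] ℤ.* ((+ 1 ℤ.+ a ℤ.- + 2) ℤ.* + 1) ≡ + 1 ℤ.- a
  normalise = solve-∀ ℤ-ring

weight : ℕ → ℚ
weight c = frac (μ c ℤ.* φ₂ c) (φ c)

weight-prime : ∀ {p} → Prime p → weight p * ofℕ (φ p) ≡ 1ℚ - ofℕ (φ p)
weight-prime {p} pr = begin
  weight p * ofℕ (φ p)      ≡⟨ frac-*-ofℕ _ (φ p) {{φ-prime-nonZero pr}} ⟩
  fromℤ (μ p ℤ.* φ₂ p)      ≡⟨ cong fromℤ (μ*φ₂-prime pr) ⟩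
  fromℤ (+ 1 ℤ.- + φ p)     ≡⟨ fromℤ-minus (+ 1) (+ φ p) ⟩
  1ℚ - ofℕ (φ p)            ∎
  where open ≡-Reasoning

-- A product of two distinct primes

module TwoPrimes {p₁ p₂ : ℕ} (prime₁ : Prime p₁) (prime₂ : Prime p₂) (p₁≢p₂ : p₁ ≢ p₂) where

  q : ℕ
  q = p₁ N.* p₂

  instance
    p₁-nonZero : NonZero p₁
    p₁-nonZero = prime⇒nonZero prime₁
    p₂-nonZero : NonZero p₂
    p₂-nonZero = prime⇒nonZero prime₂
    q-nonZero : NonZero q
    q-nonZero = N.m*n≢0 p₁ p₂

  p₁<q : p₁ < q
  p₁<q = N.m<m*n p₁ p₂ (prime⇒2≤ prime₂)

  p₂<q : p₂ < q
  p₂<q = subst (p₂ <_) (N.*-comm p₂ p₁) (N.m<m*n p₂ p₁ (prime⇒2≤ prime₁))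

  divisor-of-q : ∀ {d} → d ∣ q → d ≡ 1 ⊎ d ≡ p₁ ⊎ d ≡ p₂ ⊎ d ≡ q
  divisor-of-q {d} d∣q with p₁ ∣? d
  ... | yes (divides e refl) with prime⇒irreducible prime₂ {e} (*-cancelʳ-∣ p₁ (subst (e N.* p₁ ∣_) (N.*-comm p₁ p₂) d∣q))
  ...   | inj₁ refl = inj₂ (inj₁ (N.*-identityˡ p₁))
  ...   | inj₂ refl = inj₂ (inj₂ (inj₂ (N.*-comm p₂ p₁)))
  divisor-of-q {d} d∣q | no p₁∤d with prime⇒irreducible prime₂ (Coprime.coprime-divisor (prime∤⇒coprime prime₁ p₁∤d) d∣q)
  ...   | inj₁ d≡1 = inj₁ d≡1
  ...   | inj₂ d≡p₂ = inj₂ (inj₂ (inj₁ d≡p₂))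

  ¬prime-q : ¬ Prime q
  ¬prime-q prime-q with prime⇒irreducible prime-q (m∣m*n {p₁} p₂)
  ... | inj₁ p₁≡1 = prime⇒≢1 prime₁ p₁≡1
  ... | inj₂ p₁≡q = N.<⇒≢ p₁<q p₁≡q

  primeDivisors-q : primeDivisors q ↭ p₁ ∷ p₂ ∷ []
  primeDivisors-q = primeDivisors-↭ q ((p₁≢p₂ ∷ []) ∷ [] ∷ []) sound complete
    where
    sound : ∀ {x} → x ∈ p₁ ∷ p₂ ∷ [] → Prime x × x ∣ q
    sound (here refl) = prime₁ , m∣m*n p₂
    sound (there (here refl)) = prime₂ , n∣m*n p₁
    complete : ∀ {x} → Prime x → x ∣ q → x ∈ p₁ ∷ p₂ ∷ []
    complete px x∣q with divisor-of-q x∣q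
    ... | inj₁ refl = ⊥-elim (¬prime[1] px)
    ... | inj₂ (inj₁ refl) = here refl
    ... | inj₂ (inj₂ (inj₁ refl)) = there (here refl)
    ... | inj₂ (inj₂ (inj₂ refl)) = ⊥-elim (¬prime-q px)

  μ-q : T (squarefreeᵇ q) → μ q ≡ + 1
  μ-q squarefree = μ-two-prime-divisors q squarefree (↭-length primeDivisors-q)

  μ*φ₂-q : T (squarefreeᵇ q) → μ q ℤ.* φ₂ q ≡ (+ φ p₁ ℤ.- + 1) ℤ.* (+ φ p₂ ℤ.- + 1)
  μ*φ₂-q squarefree = begin
    μ q ℤ.* φ₂ q
      ≡⟨ cong₂ ℤ._*_ (μ-q squarefree) (φ₂-↭ q primeDivisors-q) ⟩
    + 1 ℤ.* ((+ p₁ ℤ.- + 2) ℤ.* ((+ p₂ ℤ.- + 2) ℤ.* + 1))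
      ≡⟨ cong₂ (λ m n → + 1 ℤ.* ((+ m ℤ.- + 2) ℤ.* ((+ n ℤ.- + 2) ℤ.* + 1))) (suc-φ-prime prime₁) (suc-φ-prime prime₂) ⟨
    + 1 ℤ.* ((+ suc (φ p₁) ℤ.- + 2) ℤ.* ((+ suc (φ p₂) ℤ.- + 2) ℤ.* + 1))
      ≡⟨ normalise (+ φ p₁) (+ φ p₂) ⟩
    (+ φ p₁ ℤ.- + 1) ℤ.* (+ φ p₂ ℤ.- + 1)
      ∎
    where
    open ≡-Reasoning
    normalise : ∀ a b → + 1 ℤ.* ((+ 1 ℤ.+ a ℤ.- + 2) ℤ.* ((+ 1 ℤ.+ b ℤ.- + 2) ℤ.* + 1)) ≡ (a ℤ.- + 1) ℤ.* (b ℤ.- + 1)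
    normalise = solve-∀ ℤ-ring

  ≤φ₁⇒<p₁ : ∀ {j} → j ≤ φ p₁ → j < p₁
  ≤φ₁⇒<p₁ j≤φ₁ = subst (_ <_) (suc-φ-prime prime₁) (s≤s j≤φ₁)

  coprime-to-q : ∀ {x} → ¬ p₁ ∣ x → ¬ p₂ ∣ x → Coprime x q
  coprime-to-q p₁∤x p₂∤x (c∣x , c∣q) with divisor-of-q c∣q
  ... | inj₁ c≡1 = c≡1
  ... | inj₂ (inj₁ refl) = ⊥-elim (p₁∤x c∣x)
  ... | inj₂ (inj₂ (inj₁ refl)) = ⊥-elim (p₂∤x c∣x)
  ... | inj₂ (inj₂ (inj₂ refl)) = ⊥-elim (p₁∤x (∣-trans (m∣m*n p₂) c∣x))

  -- As φ p₁ = p₁ - 1, the second part lists the multiples of p₂ up to q that p₁ does not divide.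
  multiples : List ℕ
  multiples = map (p₁ N.*_) (range1 p₂) ++ map (p₂ N.*_) (range1 (φ p₁))

  Unique-multiples : Unique multiples
  Unique-multiples = ++⁺ (map⁺ (N.*-cancelˡ-≡ _ _ p₁) (Unique-range1 p₂))
                         (map⁺ (N.*-cancelˡ-≡ _ _ p₂) (Unique-range1 (φ p₁))) disjoint
    where
    disjoint : Disjoint (map (p₁ N.*_) (range1 p₂)) (map (p₂ N.*_) (range1 (φ p₁)))
    disjoint (v∈M₁ , v∈M₂) with ∈-map⁻ (p₁ N.*_) v∈M₁ | ∈-map⁻ (p₂ N.*_) v∈M₂
    ... | i , _ , refl | j , j∈ , p₁i≡p₂j
      with euclidsLemma p₂ j prime₁ (divides i (trans (sym p₁i≡p₂j) (N.*-comm p₁ i)))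
    ...   | inj₁ p₁∣p₂ with prime⇒irreducible prime₂ p₁∣p₂
    ...     | inj₁ p₁≡1 = prime⇒≢1 prime₁ p₁≡1
    ...     | inj₂ p₁≡p₂ = p₁≢p₂ p₁≡p₂
    disjoint _ | _ | j , j∈ , _ | inj₂ p₁∣j with ∈-range1⁻ j∈
    ...     | 1≤j , j≤φ₁ = N.<⇒≱ (≤φ₁⇒<p₁ j≤φ₁) (∣⇒≤ {{N.>-nonZero 1≤j}} p₁∣j)

  nonCoprimes-q : nonCoprimes q ↭ multiples
  nonCoprimes-q = nonCoprimes-↭ q Unique-multiples sound complete
    where
    positive-factor : ∀ i {m} → 1 ≤ i N.* m → 1 ≤ i
    positive-factor (suc i) _ = s≤s z≤n
    sound : ∀ {x} → x ∈ multiples → 1 ≤ x × x ≤ q × ¬ Coprime x q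
    sound x∈ with ∈-++⁻ (map (p₁ N.*_) (range1 p₂)) x∈
    ... | inj₁ x∈M₁ with ∈-map⁻ (p₁ N.*_) x∈M₁
    ...   | i , i∈ , refl with ∈-range1⁻ i∈
    ...     | 1≤i , i≤p₂ = N.≤-trans 1≤i (N.m≤n*m i p₁) , N.*-monoʳ-≤ p₁ i≤p₂ ,
                           λ cop → prime⇒≢1 prime₁ (cop (m∣m*n i , m∣m*n p₂))
    sound x∈ | inj₂ x∈M₂ with ∈-map⁻ (p₂ N.*_) x∈M₂
    ...   | j , j∈ , refl with ∈-range1⁻ j∈
    ...     | 1≤j , j≤φ₁ = N.≤-trans 1≤j (N.m≤n*m j p₂) ,
                           subst (p₂ N.* j ≤_) (N.*-comm p₂ p₁) (N.*-monoʳ-≤ p₂ (N.<⇒≤ (≤φ₁⇒<p₁ j≤φ₁))) ,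
                           λ cop → prime⇒≢1 prime₂ (cop (m∣m*n j , n∣m*n p₁))
    complete : ∀ {x} → 1 ≤ x → x ≤ q → ¬ Coprime x q → x ∈ multiples
    complete {x} 1≤x x≤q ¬cop with p₁ ∣? x | p₂ ∣? x
    ... | yes (divides i refl) | _ =
      ∈-++⁺ˡ (subst (_∈ map (p₁ N.*_) (range1 p₂)) (N.*-comm p₁ i)
                    (∈-map⁺ (p₁ N.*_) (∈-range1⁺ (positive-factor i 1≤x) i≤p₂)))
      where
      i≤p₂ : i ≤ p₂
      i≤p₂ = N.*-cancelʳ-≤ i p₂ p₁ (subst (i N.* p₁ ≤_) (N.*-comm p₁ p₂) x≤q)
    ... | no p₁∤x | yes (divides j refl) =
      ∈-++⁺ʳ (map (p₁ N.*_) (range1 p₂)) (subst (_∈ map (p₂ N.*_) (range1 (φ p₁))) (N.*-comm p₂ j)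
                                                (∈-map⁺ (p₂ N.*_) (∈-range1⁺ (positive-factor j 1≤x) j≤φ₁)))
      where
      j≢p₁ : j ≢ p₁
      j≢p₁ refl = p₁∤x (m∣m*n p₂)
      j≤φ₁ : j ≤ φ p₁
      j≤φ₁ = N.≤-pred (subst (suc j ≤_) (sym (suc-φ-prime prime₁))
                        (N.≤∧≢⇒< (N.*-cancelʳ-≤ j p₁ p₂ x≤q) j≢p₁))
    ... | no p₁∤x | no p₂∤x = ⊥-elim (¬cop (coprime-to-q p₁∤x p₂∤x))

  φ-q : φ q ≡ φ p₁ N.* φ p₂
  φ-q = N.+-cancelʳ-≡ (p₂ N.+ φ p₁) (φ q) (φ p₁ N.* φ p₂) (trans count (sym expanded))
    where
    open ≡-Reasoning
    length-multiples : length multiples ≡ p₂ N.+ φ p₁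
    length-multiples = begin
      length multiples
        ≡⟨ length-++ (map (p₁ N.*_) (range1 p₂)) ⟩
      length (map (p₁ N.*_) (range1 p₂)) N.+ length (map (p₂ N.*_) (range1 (φ p₁)))
        ≡⟨ cong₂ N._+_ (trans (length-map _ (range1 p₂)) (length-applyUpTo suc p₂))
                       (trans (length-map _ (range1 (φ p₁))) (length-applyUpTo suc (φ p₁))) ⟩
      p₂ N.+ φ p₁
        ∎
    count : φ q N.+ (p₂ N.+ φ p₁) ≡ q
    count = trans (cong (φ q N.+_) (sym length-multiples)) (φ+length-nonCoprimes q nonCoprimes-q)
    expand : ∀ a b → a N.* b N.+ (suc b N.+ a) ≡ suc a N.* suc b
    expand = solve-∀ ℕ-ring
    expanded : φ p₁ N.* φ p₂ N.+ (p₂ N.+ φ p₁) ≡ q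
    expanded = begin
      φ p₁ N.* φ p₂ N.+ (p₂ N.+ φ p₁)
        ≡⟨ cong (λ m → φ p₁ N.* φ p₂ N.+ (m N.+ φ p₁)) (suc-φ-prime prime₂) ⟨
      φ p₁ N.* φ p₂ N.+ (suc (φ p₂) N.+ φ p₁)
        ≡⟨ expand (φ p₁) (φ p₂) ⟩
      suc (φ p₁) N.* suc (φ p₂)
        ≡⟨ cong₂ N._*_ (suc-φ-prime prime₁) (suc-φ-prime prime₂) ⟩
      q ∎

  1≢p₁ : 1 ≢ p₁
  1≢p₁ = ≢-sym (prime⇒≢1 prime₁)
  1≢p₂ : 1 ≢ p₂
  1≢p₂ = ≢-sym (prime⇒≢1 prime₂)
  1≢q : 1 ≢ q
  1≢q = 1≢p₁ ∘ sym ∘ N.m*n≡1⇒m≡1 p₁ p₂ ∘ sym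
  p₁≢q : p₁ ≢ q
  p₁≢q = N.<⇒≢ p₁<q
  p₂≢q : p₂ ≢ q
  p₂≢q = N.<⇒≢ p₂<q

  factorizations : List (ℕ × ℕ × ℕ)
  factorizations =
    (1 , q , 1) ∷ (q , 1 , 1) ∷ (p₁ , p₂ , 1) ∷ (p₂ , p₁ , 1) ∷
    (1 , p₂ , p₁) ∷ (p₂ , 1 , p₁) ∷ (1 , p₁ , p₂) ∷ (p₁ , 1 , p₂) ∷ (1 , 1 , q) ∷ []

  Unique-factorizations : Unique factorizations
  Unique-factorizations =
    (fst≢ 1≢q ∷ fst≢ 1≢p₁ ∷ fst≢ 1≢p₂ ∷ snd≢ (≢-sym p₂≢q) ∷
     fst≢ 1≢p₂ ∷ snd≢ (≢-sym p₁≢q) ∷ fst≢ 1≢p₁ ∷ snd≢ (≢-sym 1≢q) ∷ []) ∷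
    (fst≢ (≢-sym p₁≢q) ∷ fst≢ (≢-sym p₂≢q) ∷ fst≢ (≢-sym 1≢q) ∷ fst≢ (≢-sym p₂≢q) ∷
     fst≢ (≢-sym 1≢q) ∷ fst≢ (≢-sym p₁≢q) ∷ fst≢ (≢-sym 1≢q) ∷ []) ∷
    (fst≢ p₁≢p₂ ∷ fst≢ (≢-sym 1≢p₁) ∷ fst≢ p₁≢p₂ ∷
     fst≢ (≢-sym 1≢p₁) ∷ snd≢ (≢-sym 1≢p₂) ∷ fst≢ (≢-sym 1≢p₁) ∷ []) ∷
    (fst≢ (≢-sym 1≢p₂) ∷ snd≢ (≢-sym 1≢p₁) ∷ fst≢ (≢-sym 1≢p₂) ∷
     fst≢ (≢-sym p₁≢p₂) ∷ fst≢ (≢-sym 1≢p₂) ∷ []) ∷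
    (fst≢ 1≢p₂ ∷ snd≢ (≢-sym p₁≢p₂) ∷ fst≢ 1≢p₁ ∷ snd≢ (≢-sym 1≢p₂) ∷ []) ∷
    (fst≢ (≢-sym 1≢p₂) ∷ fst≢ (≢-sym p₁≢p₂) ∷ fst≢ (≢-sym 1≢p₂) ∷ []) ∷
    (fst≢ 1≢p₁ ∷ snd≢ (≢-sym 1≢p₁) ∷ []) ∷
    (fst≢ (≢-sym 1≢p₁) ∷ []) ∷
    [] ∷ []
    where
    fst≢ : ∀ {a a′ b b′ c c′ : ℕ} → a ≢ a′ → (a , b , c) ≢ (a′ , b′ , c′)
    fst≢ a≢a′ = a≢a′ ∘ cong proj₁
    snd≢ : ∀ {a a′ b b′ c c′ : ℕ} → b ≢ b′ → (a , b , c) ≢ (a′ , b′ , c′)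
    snd≢ b≢b′ = b≢b′ ∘ cong (proj₁ ∘ proj₂)

  factorizations-multiply-to-q : All (λ { (a , b , c) → a N.* b N.* c ≡ q }) factorizations
  factorizations-multiply-to-q =
    trans (N.*-identityʳ _) (N.*-identityˡ q) ∷
    trans (N.*-identityʳ _) (N.*-identityʳ q) ∷
    N.*-identityʳ q ∷
    trans (N.*-identityʳ _) (N.*-comm p₂ p₁) ∷
    trans (cong (N._* p₁) (N.*-identityˡ p₂)) (N.*-comm p₂ p₁) ∷
    trans (cong (N._* p₁) (N.*-identityʳ p₂)) (N.*-comm p₂ p₁) ∷
    cong (N._* p₂) (N.*-identityˡ p₁) ∷
    cong (N._* p₂) (N.*-identityʳ p₁) ∷
    N.*-identityˡ q ∷ []

  cofactor-unique : ∀ b {c} c′ .{{_ : NonZero b}} → b N.* c ≡ q → b N.* c′ ≡ q → c ≡ c′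
  cofactor-unique b {c} c′ bc≡q bc′≡q = N.*-cancelˡ-≡ c c′ b (trans bc≡q (sym bc′≡q))

  ∈-factorizations-1 : ∀ {b c} → b N.* c ≡ q → (1 , b , c) ∈ factorizations
  ∈-factorizations-1 {b} {c} bc≡q with divisor-of-q (divides c (trans (sym bc≡q) (N.*-comm b c)))
  ... | inj₁ refl with cofactor-unique 1 q bc≡q (N.*-identityˡ q)
  ...   | refl = ∈-lookup (# 8)
  ∈-factorizations-1 bc≡q | inj₂ (inj₁ refl) with cofactor-unique p₁ p₂ bc≡q refl
  ...   | refl = ∈-lookup (# 6)
  ∈-factorizations-1 bc≡q | inj₂ (inj₂ (inj₁ refl)) with cofactor-unique p₂ p₁ bc≡q (N.*-comm p₂ p₁)
  ...   | refl = ∈-lookup (# 4)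
  ∈-factorizations-1 bc≡q | inj₂ (inj₂ (inj₂ refl)) with cofactor-unique q 1 bc≡q (N.*-identityʳ q)
  ...   | refl = ∈-lookup (# 0)

  ∈-factorizations : ∀ {a b c} → a N.* b N.* c ≡ q → (a , b , c) ∈ factorizations
  ∈-factorizations {a} {b} {c} abc≡q
    with divisor-of-q (subst (a ∣_) abc≡q (∣m⇒∣m*n c (m∣m*n b))) | trans (sym (N.*-assoc a b c)) abc≡q
  ... | inj₁ refl | a[bc]≡q = ∈-factorizations-1 (cofactor-unique 1 q a[bc]≡q (N.*-identityˡ q))
  ... | inj₂ (inj₁ refl) | a[bc]≡q with prime-product {b = b} {c} prime₂ (cofactor-unique p₁ p₂ a[bc]≡q refl)
  ...   | inj₁ (refl , refl) = ∈-lookup (# 7)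
  ...   | inj₂ (refl , refl) = ∈-lookup (# 2)
  ∈-factorizations {b = b} {c} _ | inj₂ (inj₂ (inj₁ refl)) | a[bc]≡q
    with prime-product {b = b} {c} prime₁ (cofactor-unique p₂ p₁ a[bc]≡q (N.*-comm p₂ p₁))
  ...   | inj₁ (refl , refl) = ∈-lookup (# 5)
  ...   | inj₂ (refl , refl) = ∈-lookup (# 3)
  ∈-factorizations {b = b} {c} _ | inj₂ (inj₂ (inj₂ refl)) | a[bc]≡q
    with cofactor-unique q 1 a[bc]≡q (N.*-identityʳ q)
  ... | bc≡1 with N.m*n≡1⇒m≡1 b c bc≡1 | N.m*n≡1⇒n≡1 b c bc≡1
  ...   | refl | refl = ∈-lookup (# 1)

  triples-q : triples q ↭ factorizations
  triples-q = ↭-from-⇔ (filter⁺ (T? ∘ _) (Unique-cube (Unique-range1 q))) Unique-factorizations (mk⇔ to from)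
    where
    to : ∀ {t} → t ∈ triples q → t ∈ factorizations
    to {a , b , c} t∈ =
      ∈-factorizations (N.≡ᵇ⇒≡ (a N.* b N.* c) q (proj₂ (∈-filter⁻ (T? ∘ _) {xs = cube (range1 q)} t∈)))
    from : ∀ {t} → t ∈ factorizations → t ∈ triples q
    from {a , b , c} t∈ = ∈-filter⁺ (T? ∘ _)
      (∈-cube (divisor-∈-range1 (subst (a ∣_) abc≡q (∣m⇒∣m*n c (m∣m*n b))))
              (divisor-∈-range1 (subst (b ∣_) abc≡q (n∣m*n*o a c)))
              (divisor-∈-range1 (subst (c ∣_) abc≡q (n∣m*n (a N.* b)))))
      (N.≡⇒≡ᵇ (a N.* b N.* c) q abc≡q)
      where
      abc≡q : a N.* b N.* c ≡ q
      abc≡q = All.lookup factorizations-multiply-to-q t∈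

  φ-q-nonZero : NonZero (φ q)
  φ-q-nonZero = subst NonZero (sym φ-q) (N.m*n≢0 (φ p₁) (φ p₂) {{φ-prime-nonZero prime₁}} {{φ-prime-nonZero prime₂}})

  μ[q]/φ[q]*φ[q]≡1 : T (squarefreeᵇ q) → frac (μ q) (φ q) * ofℕ (φ q) ≡ 1ℚ
  μ[q]/φ[q]*φ[q]≡1 squarefree = trans (frac-*-ofℕ (μ q) (φ q) {{φ-q-nonZero}}) (cong fromℤ (μ-q squarefree))

  ofℕ-φ-q : ofℕ (φ q) ≡ ofℕ (φ p₁) * ofℕ (φ p₂)
  ofℕ-φ-q = trans (cong ofℕ φ-q) (ofℕ-* (φ p₁) (φ p₂))

  weight-q : T (squarefreeᵇ q) → weight q * (ofℕ (φ p₁) * ofℕ (φ p₂)) ≡ (ofℕ (φ p₁) - 1ℚ) * (ofℕ (φ p₂) - 1ℚ)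
  weight-q squarefree = begin
    weight q * (ofℕ (φ p₁) * ofℕ (φ p₂))         ≡⟨ cong (weight q *_) ofℕ-φ-q ⟨
    weight q * ofℕ (φ q)                         ≡⟨ frac-*-ofℕ _ (φ q) {{φ-q-nonZero}} ⟩
    fromℤ (μ q ℤ.* φ₂ q)                         ≡⟨ cong fromℤ (μ*φ₂-q squarefree) ⟩
    fromℤ ((+ φ p₁ ℤ.- + 1) ℤ.* (+ φ p₂ ℤ.- + 1)) ≡⟨ fromℤ-* (+ φ p₁ ℤ.- + 1) (+ φ p₂ ℤ.- + 1) ⟩
    fromℤ (+ φ p₁ ℤ.- + 1) * fromℤ (+ φ p₂ ℤ.- + 1) ≡⟨ cong₂ _*_ (fromℤ-minus (+ φ p₁) (+ 1)) (fromℤ-minus (+ φ p₂) (+ 1)) ⟩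
    (ofℕ (φ p₁) - 1ℚ) * (ofℕ (φ p₂) - 1ℚ)       ∎
    where open ≡-Reasoning

  q/φ[q]*φ[p₁]φ[p₂] : frac (+ q) (φ q) * (ofℕ (φ p₁) * ofℕ (φ p₂)) ≡ (1ℚ + ofℕ (φ p₁)) * (1ℚ + ofℕ (φ p₂))
  q/φ[q]*φ[p₁]φ[p₂] = begin
    frac (+ q) (φ q) * (ofℕ (φ p₁) * ofℕ (φ p₂))  ≡⟨ cong (frac (+ q) (φ q) *_) ofℕ-φ-q ⟨
    frac (+ q) (φ q) * ofℕ (φ q)                  ≡⟨ frac-*-ofℕ (+ q) (φ q) {{φ-q-nonZero}} ⟩
    ofℕ q                                         ≡⟨ ofℕ-* p₁ p₂ ⟩
    ofℕ p₁ * ofℕ p₂                               ≡⟨ cong₂ (λ m n → ofℕ m * ofℕ n) (suc-φ-prime prime₁) (suc-φ-prime prime₂) ⟨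
    ofℕ (suc (φ p₁)) * ofℕ (suc (φ p₂))           ≡⟨ cong₂ _*_ (ofℕ-suc (φ p₁)) (ofℕ-suc (φ p₂)) ⟩
    (1ℚ + ofℕ (φ p₁)) * (1ℚ + ofℕ (φ p₂))         ∎
    where open ≡-Reasoning

  -- ξ_q(N/ℓ) in terms of L = [ℓ ≤ N], A = [ℓp₁ ≤ N], B = [ℓp₂ ≤ N] and Q = [ℓq ≤ N],
  -- with one summand per element of factorizations.
  ξ-profile : (L A B Q : Bool) → ℚ
  ξ-profile L A B Q =
    [ L ∧ Q ]· 1ℚ + ([ Q ∧ L ]· 1ℚ + ([ A ∧ B ]· 1ℚ + ([ B ∧ A ]· 1ℚ +
    ([ A ∧ Q ]· weight p₁ + ([ Q ∧ A ]· weight p₁ + ([ B ∧ Q ]· weight p₂ + ([ Q ∧ B ]· weight p₂ +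
    ([ Q ∧ Q ]· weight q + 0ℚ))))))))

  admissible : ℕ → ℕ → ℕ × ℕ × ℕ → Bool
  admissible ℓ N (a , b , c) = (ℓ N.* a N.* c ≤ᵇ N) ∧ (ℓ N.* b N.* c ≤ᵇ N)

  ξ-q≡ξ-profile : ∀ ℓ N → ξ q ℓ N ≡ ξ-profile (ℓ ≤ᵇ N) (ℓ N.* p₁ ≤ᵇ N) (ℓ N.* p₂ ≤ᵇ N) (ℓ N.* q ≤ᵇ N)
  ξ-q≡ξ-profile ℓ N =
    trans (sumℚ-map-filterᵇ-↭ weight₃ (admissible ℓ N) triples-q)
          (trans (sumℚ-map-filterᵇ weight₃ (admissible ℓ N) factorizations) normalise)
    where
    weight₃ : ℕ × ℕ × ℕ → ℚ
    weight₃ (_ , _ , c) = weight c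
    normalise : foldr (λ t s → [ admissible ℓ N t ]· weight₃ t + s) 0ℚ factorizations ≡
                ξ-profile (ℓ ≤ᵇ N) (ℓ N.* p₁ ≤ᵇ N) (ℓ N.* p₂ ≤ᵇ N) (ℓ N.* q ≤ᵇ N)
    normalise
      rewrite N.*-identityʳ (ℓ N.* 1) | N.*-identityʳ ℓ
            | N.*-identityʳ (ℓ N.* q) | N.*-identityʳ (ℓ N.* p₁) | N.*-identityʳ (ℓ N.* p₂)
            | N.*-assoc ℓ p₁ p₂ | N.*-assoc ℓ p₂ p₁ | N.*-comm p₂ p₁ = refl

  ξ-bound : ℚ
  ξ-bound = ofℕ 2 ⊔ frac (+ q) (φ q)

  ξ-bound-nonNeg : 0ℚ Q.≤ ξ-bound
  ξ-bound-nonNeg = Q.≤-trans (frac-nonNeg 2 1) (Q.p≤p⊔q (ofℕ 2) (frac (+ q) (φ q)))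

  ξ-profile-full : T (squarefreeᵇ q) → ξ-profile true true true true ≡ frac (+ q) (φ q)
  ξ-profile-full squarefree =
    ξ-full-sum-identity (ofℕ (φ p₁)) (ofℕ (φ p₂)) (weight p₁) (weight p₂) (weight q) (frac (+ q) (φ q))
      (subst (_≢ 0ℚ) ofℕ-φ-q (ofℕ-≢0 (φ q) {{φ-q-nonZero}}))
      (weight-prime prime₁) (weight-prime prime₂) (weight-q squarefree) q/φ[q]*φ[p₁]φ[p₂]

  ξ-profile-≤2 : ∀ L A B → 0ℚ Q.≤ ξ-profile L A B false × ξ-profile L A B false Q.≤ ofℕ 2
  ξ-profile-≤2 false false false = ≤-by-computation _ , ≤-by-computation _
  ξ-profile-≤2 false false true  = ≤-by-computation _ , ≤-by-computation _
  ξ-profile-≤2 false true  false = ≤-by-computation _ , ≤-by-computation _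
  ξ-profile-≤2 false true  true  = ≤-by-computation _ , ≤-by-computation _
  ξ-profile-≤2 true  false false = ≤-by-computation _ , ≤-by-computation _
  ξ-profile-≤2 true  false true  = ≤-by-computation _ , ≤-by-computation _
  ξ-profile-≤2 true  true  false = ≤-by-computation _ , ≤-by-computation _
  ξ-profile-≤2 true  true  true  = ≤-by-computation _ , ≤-by-computation _

  ξ-profile-bounds : T (squarefreeᵇ q) → ∀ L A B Q → (T Q → T L × T A × T B) →
                     0ℚ Q.≤ ξ-profile L A B Q × ξ-profile L A B Q Q.≤ ξ-bound
  ξ-profile-bounds squarefree true true true true _ =
    subst (λ v → 0ℚ Q.≤ v × v Q.≤ ξ-bound) (sym (ξ-profile-full squarefree))
          (frac-nonNeg q (φ q) , Q.p≤q⊔p (ofℕ 2) (frac (+ q) (φ q)))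
  ξ-profile-bounds _ false _     _     true Q⇒LAB = ⊥-elim (proj₁ (Q⇒LAB _))
  ξ-profile-bounds _ true  false _     true Q⇒LAB = ⊥-elim (proj₁ (proj₂ (Q⇒LAB _)))
  ξ-profile-bounds _ true  true  false true Q⇒LAB = ⊥-elim (proj₂ (proj₂ (Q⇒LAB _)))
  ξ-profile-bounds _ L A B false _ with ξ-profile-≤2 L A B
  ... | ξ≥0 , ξ≤2 = ξ≥0 , Q.≤-trans ξ≤2 (Q.p≤p⊔q (ofℕ 2) (frac (+ q) (φ q)))

  ξ-q-bounds : T (squarefreeᵇ q) → ∀ ℓ N → 0ℚ Q.≤ ξ q ℓ N × ξ q ℓ N Q.≤ ξ-bound
  ξ-q-bounds squarefree ℓ N =
    subst (λ v → 0ℚ Q.≤ v × v Q.≤ ξ-bound) (sym (ξ-q≡ξ-profile ℓ N))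
          (ξ-profile-bounds squarefree _ _ _ _ divisors-admissible)
    where
    divisors-admissible : T (ℓ N.* q ≤ᵇ N) → T (ℓ ≤ᵇ N) × T (ℓ N.* p₁ ≤ᵇ N) × T (ℓ N.* p₂ ≤ᵇ N)
    divisors-admissible ℓq≤ᵇN =
      N.≤⇒≤ᵇ (N.≤-trans (N.m≤m*n ℓ q) ℓq≤N) ,
      N.≤⇒≤ᵇ (N.≤-trans (N.*-monoʳ-≤ ℓ (N.<⇒≤ p₁<q)) ℓq≤N) ,
      N.≤⇒≤ᵇ (N.≤-trans (N.*-monoʳ-≤ ℓ (N.<⇒≤ p₂<q)) ℓq≤N)
      where
      ℓq≤N : ℓ N.* q ≤ N
      ℓq≤N = N.≤ᵇ⇒≤ (ℓ N.* q) N ℓq≤ᵇN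

-- Bounds for G_[q] and w_q

n≤n*n : ∀ n → n ≤ n N.* n
n≤n*n zero = z≤n
n≤n*n n@(suc _) = N.m≤m*n n n

≤-of-square-≤ : ∀ {ℓ q M N} .{{_ : NonZero q}} → ℓ N.* ℓ N.* q ≤ M → M < suc N N.* suc N → ℓ ≤ N
≤-of-square-≤ {ℓ} {q} {M} {N} ℓ²q≤M M<[N+1]² with ℓ N.≤? N
... | yes ℓ≤N = ℓ≤N
... | no ℓ≰N =
  ⊥-elim (N.<⇒≱ M<[N+1]² (N.≤-trans (N.*-mono-≤ N<ℓ N<ℓ) (N.≤-trans (N.m≤m*n (ℓ N.* ℓ) q) ℓ²q≤M)))
  where
  N<ℓ : N < ℓ
  N<ℓ = N.≰⇒> ℓ≰N

G-nonNeg : ∀ τ n0 N → 0ℚ Q.≤ G τ n0 N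
G-nonNeg τ n0 N = sumℚ-map-nonNeg _ (filterᵇ (λ ℓ → coprimeᵇ ℓ (τ N.* Pz n0)) (range1 N))
                                   (λ ℓ → frac-square-nonNeg (μ ℓ) (φ ℓ))

Gbr-bounds : ∀ q n0 τ N M c .{{_ : NonZero q}} → N N.* N ≤ M → M < suc N N.* suc N → 0ℚ Q.≤ c →
             (∀ ℓ → 0ℚ Q.≤ ξ q ℓ N × ξ q ℓ N Q.≤ c) →
             0ℚ Q.≤ Gbr q n0 τ N M × Gbr q n0 τ N M Q.≤ c * G τ n0 N
Gbr-bounds q n0 τ N M c N²≤M M<[N+1]² c≥0 ξ-bounds =
  sumℚ-map-nonNeg (λ ℓ → m ℓ * ξ q ℓ N) (filterᵇ inGbr (range1 M))
                  (λ ℓ → *-nonNeg (m≥0 ℓ) (proj₁ (ξ-bounds ℓ))) ,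
  (begin
    Gbr q n0 τ N M                                           ≤⟨ sumℚ-map-≤-* _ m c (filterᵇ inGbr (range1 M)) m*ξ≤c*m ⟩
    c * sumℚ (map m (filterᵇ inGbr (range1 M)))              ≡⟨ cong (λ ℓs → c * sumℚ (map m ℓs)) only-ℓ≤N ⟩
    c * sumℚ (map m (filterᵇ inGbr (range1 N)))              ≤⟨ Q.*-monoˡ-≤-nonNeg c {{Q.nonNegative c≥0}}
                                                                  (sumℚ-map-filterᵇ-mono m inGbr inG (range1 N) m≥0 inGbr⇒inG) ⟩
    c * G τ n0 N                                             ∎)
  where
  open Q.≤-Reasoning
  m : ℕ → ℚ
  m ℓ = frac (μ ℓ ℤ.* μ ℓ) (φ ℓ)
  m≥0 : ∀ ℓ → 0ℚ Q.≤ m ℓ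
  m≥0 ℓ = frac-square-nonNeg (μ ℓ) (φ ℓ)
  inG inGbr : ℕ → Bool
  inG ℓ = coprimeᵇ ℓ (τ N.* Pz n0)
  inGbr ℓ = ((ℓ N.* ℓ N.* q) ≤ᵇ M) ∧ coprimeᵇ ℓ (q N.* τ N.* Pz n0)
  m*ξ≤c*m : ∀ ℓ → m ℓ * ξ q ℓ N Q.≤ c * m ℓ
  m*ξ≤c*m ℓ = Q.≤-trans (Q.*-monoˡ-≤-nonNeg (m ℓ) {{Q.nonNegative (m≥0 ℓ)}} (proj₂ (ξ-bounds ℓ)))
                        (Q.≤-reflexive (Q.*-comm (m ℓ) c))
  inGbr⇒≤N : ∀ ℓ → T (inGbr ℓ) → ℓ ≤ N
  inGbr⇒≤N ℓ t = ≤-of-square-≤ (N.≤ᵇ⇒≤ _ M (proj₁ (Equivalence.to T-∧ t))) M<[N+1]²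
  only-ℓ≤N : filterᵇ inGbr (range1 M) ≡ filterᵇ inGbr (range1 N)
  only-ℓ≤N = trans (cong (filterᵇ inGbr ∘ range1) (sym (N.m+[n∸m]≡n (N.≤-trans (n≤n*n N) N²≤M))))
                   (filterᵇ-range1-+ inGbr N (M N.∸ N) inGbr⇒≤N)
  inGbr⇒inG : ∀ ℓ → T (inGbr ℓ) → T (inG ℓ)
  inGbr⇒inG ℓ t = T-does⁺ (coprime? ℓ (τ N.* Pz n0)) λ {d} (d∣ℓ , d∣τP) →
    T-does⁻ (coprime? ℓ (q N.* τ N.* Pz n0)) (proj₂ (Equivalence.to T-∧ t))
      (d∣ℓ , subst (d ∣_) (sym (N.*-assoc q τ (Pz n0))) (∣n⇒∣m*n q d∣τP))

w-cases : ∀ q n0 τ N M → w q n0 τ N M ≡ 0ℚ ⊎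
          (T (squarefreeᵇ q) × w q n0 τ N M ≡ (frac (μ q) (φ q) ÷' G τ n0 N) * (Gbr q n0 τ N M ÷' G τ n0 N))
w-cases q n0 τ N M with squarefreeᵇ q | coprimeᵇ q (τ N.* Pz n0)
... | true  | true  = inj₂ (_ , refl)
... | true  | false = inj₁ refl
... | false | _     = inj₁ refl

w*G*φ-bounds : ∀ q n0 τ N M c → 0ℚ Q.≤ c →
               (T (squarefreeᵇ q) → frac (μ q) (φ q) * ofℕ (φ q) ≡ 1ℚ) →
               (T (squarefreeᵇ q) → 0ℚ Q.≤ Gbr q n0 τ N M × Gbr q n0 τ N M Q.≤ c * G τ n0 N) →
               w q n0 τ N M * G τ n0 N * ofℕ (φ q) Q.≤ c × 0ℚ Q.≤ w q n0 τ N M * G τ n0 N * ofℕ (φ q)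
w*G*φ-bounds q n0 τ N M c c≥0 a*F≡1 Gbr-bounds = by-cases (w-cases q n0 τ N M)
  where
  g b a F v : ℚ
  g = G τ n0 N
  b = Gbr q n0 τ N M
  a = frac (μ q) (φ q)
  F = ofℕ (φ q)
  v = w q n0 τ N M * g * F

  vanishing : v ≡ 0ℚ → v Q.≤ c × 0ℚ Q.≤ v
  vanishing v≡0 = subst (λ x → x Q.≤ c × 0ℚ Q.≤ x) (sym v≡0) (c≥0 , Q.≤-refl)

  nonvanishing : T (squarefreeᵇ q) → w q n0 τ N M ≡ (a ÷' g) * (b ÷' g) → g ≢ 0ℚ → v Q.≤ c × 0ℚ Q.≤ v
  nonvanishing squarefree w≡ g≢0 =
    subst (Q._≤ c) (sym v≡b/g) (proj₂ b/g-bounds) , subst (0ℚ Q.≤_) (sym v≡b/g) (proj₁ b/g-bounds)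
    where
    instance
      g-nonZero : Q.NonZero g
      g-nonZero = Q.≢-nonZero g≢0
    b/g-bounds : 0ℚ Q.≤ b * 1/ g × b * 1/ g Q.≤ c
    b/g-bounds = *-1/-bounds b g c (G-nonNeg τ n0 N) g≢0
                             (proj₁ (Gbr-bounds squarefree)) (proj₂ (Gbr-bounds squarefree))
    rearrange : ∀ a b g⁻¹ g F → ((a * g⁻¹) * (b * g⁻¹)) * g * F ≡ (a * F) * (b * g⁻¹) * (g⁻¹ * g)
    rearrange = solve-∀ ℚ-ring
    v≡b/g : v ≡ b * 1/ g
    v≡b/g = begin
      w q n0 τ N M * g * F                   ≡⟨ cong (λ x → x * g * F) w≡ ⟩
      (a ÷' g) * (b ÷' g) * g * F            ≡⟨ cong₂ (λ x y → x * y * g * F) (÷'-≢0 a g g≢0) (÷'-≢0 b g g≢0) ⟩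
      (a * 1/ g) * (b * 1/ g) * g * F        ≡⟨ rearrange a b (1/ g) g F ⟩
      (a * F) * (b * 1/ g) * (1/ g * g)      ≡⟨ cong₂ (λ x y → x * (b * 1/ g) * y) (a*F≡1 squarefree) (Q.*-inverseˡ g) ⟩
      1ℚ * (b * 1/ g) * 1ℚ                   ≡⟨ trans (Q.*-identityʳ _) (Q.*-identityˡ _) ⟩
      b * 1/ g                               ∎
      where open ≡-Reasoning

  by-cases : w q n0 τ N M ≡ 0ℚ ⊎ (T (squarefreeᵇ q) × w q n0 τ N M ≡ (a ÷' g) * (b ÷' g)) →
             v Q.≤ c × 0ℚ Q.≤ v
  by-cases (inj₁ w≡0) =
    vanishing (trans (cong (λ x → x * g * F) w≡0) (trans (cong (_* F) (Q.*-zeroˡ g)) (Q.*-zeroˡ F)))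
  by-cases (inj₂ (squarefree , w≡)) = by-g≟0 (g Q.≟ 0ℚ)
    where
    by-g≟0 : Dec (g ≡ 0ℚ) → v Q.≤ c × 0ℚ Q.≤ v
    by-g≟0 (yes g≡0) = vanishing (trans (cong (λ x → w q n0 τ N M * x * F) g≡0)
                                        (trans (cong (_* F) (Q.*-zeroʳ (w q n0 τ N M))) (Q.*-zeroˡ F)))
    by-g≟0 (no g≢0) = nonvanishing squarefree w≡ g≢0

lemma12 : (n0 : ℕ) → 2 ≤ n0 → (Nz Mz : ℕ) → 1 ≤ Nz → Nz N.* Nz ≤ Mz → Mz < suc Nz N.* suc Nz →
            (τ : ℕ) → 1 ≤ τ → Coprime τ (Pz n0) →
            (p₁ p₂ : ℕ) → Prime p₁ → Prime p₂ → p₁ ≢ p₂ →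
            (w (p₁ N.* p₂) n0 τ Nz Mz Q.* G τ n0 Nz Q.* ofℕ (φ (p₁ N.* p₂))
               Q.≤ (ofℕ 2 ⊔ frac (Data.Integer.+_ (p₁ N.* p₂)) (φ (p₁ N.* p₂))))
            × (0ℚ Q.≤ w (p₁ N.* p₂) n0 τ Nz Mz Q.* G τ n0 Nz Q.* ofℕ (φ (p₁ N.* p₂)))
lemma12 n0 _ Nz Mz _ Nz²≤Mz Mz<[Nz+1]² τ _ _ p₁ p₂ prime₁ prime₂ p₁≢p₂ =
  w*G*φ-bounds q n0 τ Nz Mz ξ-bound ξ-bound-nonNeg μ[q]/φ[q]*φ[q]≡1
    (λ squarefree → Gbr-bounds q n0 τ Nz Mz ξ-bound Nz²≤Mz Mz<[Nz+1]² ξ-bound-nonNeg (λ ℓ → ξ-q-bounds squarefree ℓ Nz))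
  where open TwoPrimes prime₁ prime₂ p₁≢p₂
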